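{- Let $q > 5$ be a Sophie Germain prime, let $p = 2q+1$, and suppose $z(p) \mid \pi(q)$. Then the Legendre symbol $\left(\frac{5}{p}\right) = -1$.
   Context: A Sophie Germain prime is a prime $q$ with $2q+1$ prime. $F_n$ denotes the $n$-th Fibonacci number ($F_0=0$, $F_1=1$, $F_n=F_{n-1}+F_{n-2}$). For a prime $p$, $z(p)$ is the smallest positive integer $k$ with $p \mid F_k$. For a positive integer $n$, the Pisano period $\pi(n)$ is the period of $(F_m \bmod n)_{m\ge0}$. -}

module Defs where

import Data.Nat
open import Data.Nat using (ℕ; zero; suc; _+_; _*_; _<_; _≤_; _%_; NonZero)
open import Data.Nat.Divisibility using (_∣_; _∣?_)
open import Data.Nat.Primality using (Prime)
open import Data.Integer using (ℤ; +_; -[1+_])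
open import Data.Fin using (Fin; toℕ)
open import Data.Fin.Properties using (any?)
open import Data.Product using (_×_; Σ; ∃)
open import Relation.Nullary using (¬_; yes; no)
open import Relation.Binary.PropositionalEquality using (_≡_)

F : ℕ → ℕ
F zero = 0
F (suc zero) = 1
F (suc (suc n)) = F (suc n) + F n

SophieGermain : ℕ → Set
SophieGermain q = Prime q × Prime (suc (2 * q))

IsRankOfApparition : ℕ → ℕ → Set
IsRankOfApparition p k =
  (0 < k) × (p ∣ F k) × (∀ j → 0 < j → p ∣ F j → k ≤ j)


IsPisanoPeriod : (n : ℕ) → .{{NonZero n}} → ℕ → Set
IsPisanoPeriod n k =
  (0 < k) × (∀ m → F (m + k) % n ≡ F m % n)
  × (∀ j → 0 < j → (∀ m → F (m + j) % n ≡ F m % n) → k ≤ j)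

legendre : (a p : ℕ) → .{{NonZero p}} → ℤ
legendre a p with p ∣? a
... | yes _ = + 0
... | no _ with any? (λ (x : Fin p) → (toℕ x * toℕ x) % p Data.Nat.≟ a % p)
...   | yes _ = + 1
...   | no _ = -[1+ 0 ]

{-# OPTIONS --safe #-}
module Submission where

-- Write p = 2q + 1.  Expanding (1 + √5)^p = 2^(p-1) ((2 F(p-1) + F p) + F p √5) in ℕ[√5] by the
-- binomial theorem, all middle coefficients are divisible by p, so modulo p
--   F p ≡ 5^q   and   2 F(p-1) + F p ≡ 1.
-- If 5 were a square modulo p, then 5^q ≡ 1 by Euler's criterion, hence p ∣ F(p-1) = F(2q) and
-- z(p) ∣ 2q.  As F 1 = F 2 = 1, z(p) is neither 1 nor 2, so q ∣ z(p) ∣ π(q).  But the same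
-- congruences for the prime q (≠ 2, 5) give F(q-1) ≡ 0, F q ≡ 1 or F(q-1) ≡ 1, F q ≡ -1, so
-- π(q) divides q - 1 or 2(q + 1), neither of which is a multiple of q.

open import Level using (0ℓ)
open import Algebra.Bundles using (CommutativeSemiring)
open import Algebra.Structures.Biased using (isCommutativeSemiringˡ; isCommutativeMonoidˡ)
open import Data.Nat using (ℕ; zero; suc; _∸_; _<_; _≤_; s≤s; z≤n; NonZero)
import Data.Nat as ℕ
import Data.Nat.Properties as ℕ
open import Data.Nat.Combinatorics using (_C_; nCn≡1; nC1≡n; nCk+nC[k+1]≡[n+1]C[k+1])
open import Data.Nat.Coprimality using (Coprime; coprime-divisor)
open import Data.Nat.DivMod using (m≡m%n+[m/n]*n; [m+kn]%n≡m%n; m%n<n)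
open import Data.Nat.Divisibility as ℕ∣ using (_∣_)
open import Data.Nat.Primality using (Prime; euclidsLemma; prime⇒irreducible; ¬prime[1])
open import Data.Nat.Tactic.RingSolver using (solve-∀)
open import Data.Fin as Fin using (Fin; toℕ; fromℕ; inject₁)
open import Data.Fin.Properties using (toℕ-fromℕ; toℕ-inject₁; toℕ<n; any?)
open import Data.Vec.Functional using (Vector)
open import Data.Product using (_,_; ∃-syntax; proj₁; proj₂)
open import Data.Sum as Sum using (_⊎_; inj₁; inj₂)
open import Function using (_∘_)
open import Relation.Binary.Bundles using (Setoid)
import Relation.Binary.Reasoning.Setoid as SetoidReasoning
open import Relation.Nullary using (¬_; yes; no; contradiction)
open import Relation.Binary.PropositionalEquality as ≡ using (_≡_; cong; cong₂; subst)

module _ where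
  open import Data.Nat using (_+_; _*_)

  [1+k]*[1+n]C[1+k]≡[1+n]*nCk : ∀ n k → suc k * (suc n C suc k) ≡ suc n * (n C k)
  [1+k]*[1+n]C[1+k]≡[1+n]*nCk zero    zero    = ≡.refl
  [1+k]*[1+n]C[1+k]≡[1+n]*nCk zero    (suc k) = ℕ.*-zeroʳ (2 + k)
  [1+k]*[1+n]C[1+k]≡[1+n]*nCk (suc n) zero    =
    ≡.trans (ℕ.*-identityˡ _) (≡.trans (nC1≡n (2 + n)) (≡.sym (ℕ.*-identityʳ (2 + n))))
  [1+k]*[1+n]C[1+k]≡[1+n]*nCk (suc n) (suc k) = begin
    (2 + k) * ((2 + n) C (2 + k))                    ≡⟨ cong ((2 + k) *_) (nCk+nC[k+1]≡[n+1]C[k+1] (1 + n) (1 + k)) ⟨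
    (2 + k) * (c + d)                                ≡⟨ expand k c d ⟩
    c + ((1 + k) * c + (2 + k) * d)                  ≡⟨ cong (c +_) (cong₂ _+_ ih₁ ih₂) ⟩
    c + ((1 + n) * (n C k) + (1 + n) * (n C suc k))  ≡⟨ cong (c +_) (ℕ.*-distribˡ-+ (1 + n) (n C k) _) ⟨
    c + (1 + n) * (n C k + n C suc k)                ≡⟨ cong (λ t → c + (1 + n) * t) (nCk+nC[k+1]≡[n+1]C[k+1] n k) ⟩
    (2 + n) * c                                      ∎
    where
    open ≡.≡-Reasoning
    c d : ℕ
    c = suc n C suc k
    d = suc n C suc (suc k)
    ih₁ : (1 + k) * c ≡ (1 + n) * (n C k)
    ih₁ = [1+k]*[1+n]C[1+k]≡[1+n]*nCk n k
    ih₂ : (2 + k) * d ≡ (1 + n) * (n C suc k)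
    ih₂ = [1+k]*[1+n]C[1+k]≡[1+n]*nCk n (suc k)
    expand : ∀ k c d → (2 + k) * (c + d) ≡ c + ((1 + k) * c + (2 + k) * d)
    expand = solve-∀

  prime∣pCk : ∀ {n k} → Prime (suc n) → k < n → suc n ∣ suc n C suc k
  prime∣pCk {n} {k} p-prime k<n
    with euclidsLemma (suc k) (suc n C suc k) p-prime
           (subst (suc n ∣_) (≡.sym ([1+k]*[1+n]C[1+k]≡[1+n]*nCk n k)) (ℕ∣.m∣m*n (n C k)))
  ... | inj₁ p∣1+k = contradiction p∣1+k (ℕ∣.>⇒∤ (s≤s k<n))
  ... | inj₂ p∣pCk = p∣pCk

module _ {a ℓ} (S : CommutativeSemiring a ℓ) where
  open CommutativeSemiring S
  open import Algebra.Properties.Semiring.Exp semiring using (_^_)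
  open import Algebra.Properties.Semiring.Mult semiring using (_×_; ×-congˡ; ×-assocˡ)
  open import Algebra.Properties.CommutativeMonoid.Mult +-commutativeMonoid using (×-distrib-+)
  open import Algebra.Properties.Semiring.Sum semiring
    using (sum; sum-init-last; sum-cong-≋; sum-replicate; sum-replicate-zero)
  open import Algebra.Properties.CommutativeSemiring.Binomial S using (theorem; binomial; binomialTerm)
  open import Relation.Binary.Reasoning.Setoid setoid

  ×-distrib-sum : ∀ m {n} (f : Vector Carrier n) → m × sum f ≈ sum (λ i → m × f i)
  ×-distrib-sum m {zero}  f = trans (sym (sum-replicate m)) (sum-replicate-zero m)
  ×-distrib-sum m {suc n} f =
    trans (×-distrib-+ (f Fin.zero) _ m) (+-congˡ (×-distrib-sum m (f ∘ Fin.suc)))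

  -- The middle terms of the binomial expansion are multiples of p, as p ∣ p C k for 0 < k < p.
  frobenius : ∀ {p} → Prime p → ∀ x y → ∃[ w ] (x + y) ^ p ≈ x ^ p + y ^ p + p × w
  frobenius {zero} ()
  frobenius {p@(suc n)} p-prime x y = sum middle , (begin
    (x + y) ^ p                                        ≈⟨ theorem p x y ⟩
    term Fin.zero + sum (term ∘ Fin.suc)               ≈⟨ +-cong first (sum-init-last (term ∘ Fin.suc)) ⟩
    y ^ p + (sum (term ∘ Fin.suc ∘ inject₁) + term (fromℕ p))
                                                       ≈⟨ +-congˡ (+-cong middle-terms last) ⟩
    y ^ p + (p × sum middle + x ^ p)                   ≈⟨ rearrange ⟩
    x ^ p + y ^ p + p × sum middle                     ∎)
    where
    term : Fin (suc p) → Carrier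
    term = binomialTerm x y p

    first : term Fin.zero ≈ y ^ p
    first = trans (+-identityʳ _) (*-identityˡ _)

    last : term (fromℕ p) ≈ x ^ p
    last = begin
      (p C suc (toℕ (fromℕ n))) × (x ^ suc (toℕ (fromℕ n)) * y ^ (n ∸ toℕ (fromℕ n)))
        ≡⟨ cong (λ k → (p C suc k) × (x ^ suc k * y ^ (n ∸ k))) (toℕ-fromℕ n) ⟩
      (p C p) × (x ^ p * y ^ (n ∸ n))
        ≡⟨ cong₂ (λ c e → c × (x ^ p * y ^ e)) (nCn≡1 p) (ℕ.n∸n≡0 n) ⟩
      1 × (x ^ p * 1#)
        ≈⟨ trans (+-identityʳ _) (*-identityʳ _) ⟩
      x ^ p
        ∎

    coefficient : Fin n → ℕ
    coefficient i = ℕ∣.quotient (prime∣pCk p-prime (toℕ<n i))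

    middle : Fin n → Carrier
    middle i = coefficient i × binomial x y p (Fin.suc (inject₁ i))

    p*coefficient : ∀ i → p C suc (toℕ (inject₁ i)) ≡ p ℕ.* coefficient i
    p*coefficient i = ≡.trans (cong (λ k → p C suc k) (toℕ-inject₁ i))
      (≡.trans (ℕ∣.m∣n⇒n≡quotient*m (prime∣pCk p-prime (toℕ<n i))) (ℕ.*-comm (coefficient i) p))

    middle-terms : sum (term ∘ Fin.suc ∘ inject₁) ≈ p × sum middle
    middle-terms = trans
      (sum-cong-≋ (λ i → trans (×-congˡ (p*coefficient i)) (sym (×-assocˡ _ p (coefficient i)))))
      (sym (×-distrib-sum p middle))

    rearrange : ∀ {u v w} → v + (w + u) ≈ u + v + w
    rearrange {u} {v} {w} =
      trans (+-congˡ (+-comm w u)) (trans (sym (+-assoc v u w)) (+-congʳ (+-comm v u)))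

-- The operators of ℕ and ℤ are opened only from here on, as the section above uses the
-- semiring's _+_, _*_ and _^_.
open import Data.Nat using (_+_; _*_; _^_; _%_; _/_)
open import Data.Product using (_×_)
import Data.Integer as ℤ
open import Data.Integer using (ℤ; +_; -[1+_]; 0ℤ; 1ℤ; -1ℤ)
import Data.Integer.Properties as ℤ
import Data.Integer.Divisibility.Signed as ℤ∣
import Data.Integer.Tactic.RingSolver as ℤ-Solver
open import Defs

module ℕ[√d] (d : ℕ) where

  -- (a , b) stands for a + b √d.
  infixl 6 _⊕_
  infixl 7 _⊗_

  _⊕_ : ℕ × ℕ → ℕ × ℕ → ℕ × ℕ
  (a , b) ⊕ (c , e) = (a + c , b + e)

  _⊗_ : ℕ × ℕ → ℕ × ℕ → ℕ × ℕ
  (a , b) ⊗ (c , e) = (a * c + d * (b * e) , a * e + b * c)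

  private
    ⊗-assoc₁ : ∀ d a b c e f g →
      (a * c + d * (b * e)) * f + d * ((a * e + b * c) * g) ≡
      a * (c * f + d * (e * g)) + d * (b * (c * g + e * f))
    ⊗-assoc₁ = solve-∀
    ⊗-assoc₂ : ∀ d a b c e f g →
      (a * c + d * (b * e)) * g + (a * e + b * c) * f ≡
      a * (c * g + e * f) + b * (c * f + d * (e * g))
    ⊗-assoc₂ = solve-∀
    ⊗-comm₁ : ∀ d a b c e → a * c + d * (b * e) ≡ c * a + d * (e * b)
    ⊗-comm₁ = solve-∀
    ⊗-comm₂ : ∀ d a b c e → a * e + b * c ≡ c * b + e * a
    ⊗-comm₂ = solve-∀
    ⊗-identity₁ : ∀ d a b → 1 * a + d * (0 * b) ≡ a
    ⊗-identity₁ = solve-∀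
    ⊗-identity₂ : ∀ d a b → 1 * b + 0 * a ≡ b
    ⊗-identity₂ = solve-∀
    distrib₁ : ∀ d a b c e f g →
      (a + c) * f + d * ((b + e) * g) ≡ (a * f + d * (b * g)) + (c * f + d * (e * g))
    distrib₁ = solve-∀
    distrib₂ : ∀ d a b c e f g → (a + c) * g + (b + e) * f ≡ (a * g + b * f) + (c * g + e * f)
    distrib₂ = solve-∀
    zero₁ : ∀ d a b → 0 * a + d * (0 * b) ≡ 0
    zero₁ = solve-∀
    zero₂ : ∀ d a b → 0 * b + 0 * a ≡ 0
    zero₂ = solve-∀

  +-*-commutativeSemiring : CommutativeSemiring 0ℓ 0ℓ
  +-*-commutativeSemiring = record
    { Carrier = ℕ × ℕ ; _≈_ = _≡_ ; _+_ = _⊕_ ; _*_ = _⊗_ ; 0# = (0 , 0) ; 1# = (1 , 0)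
    ; isCommutativeSemiring = isCommutativeSemiringˡ record
      { +-isCommutativeMonoid = isCommutativeMonoidˡ record
        { isSemigroup = record
          { isMagma = record { isEquivalence = ≡.isEquivalence ; ∙-cong = cong₂ _⊕_ }
          ; assoc   = λ { (a , b) (c , e) (f , g) → cong₂ _,_ (ℕ.+-assoc a c f) (ℕ.+-assoc b e g) } }
        ; identityˡ = λ _ → ≡.refl
        ; comm      = λ { (a , b) (c , e) → cong₂ _,_ (ℕ.+-comm a c) (ℕ.+-comm b e) } }
      ; *-isCommutativeMonoid = isCommutativeMonoidˡ record
        { isSemigroup = record
          { isMagma = record { isEquivalence = ≡.isEquivalence ; ∙-cong = cong₂ _⊗_ }
          ; assoc   = λ { (a , b) (c , e) (f , g) →
                          cong₂ _,_ (⊗-assoc₁ d a b c e f g) (⊗-assoc₂ d a b c e f g) } }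
        ; identityˡ = λ { (a , b) → cong₂ _,_ (⊗-identity₁ d a b) (⊗-identity₂ d a b) }
        ; comm      = λ { (a , b) (c , e) → cong₂ _,_ (⊗-comm₁ d a b c e) (⊗-comm₂ d a b c e) } }
      ; distribʳ = λ { (f , g) (a , b) (c , e) →
                       cong₂ _,_ (distrib₁ d a b c e f g) (distrib₂ d a b c e f g) }
      ; zeroˡ    = λ { (a , b) → cong₂ _,_ (zero₁ d a b) (zero₂ d a b) } } }

  open CommutativeSemiring +-*-commutativeSemiring using (semiring; *-identityˡ)
  open import Algebra.Properties.Semiring.Exp semiring public using () renaming (_^_ to _⊗^_)
  open import Algebra.Properties.Semiring.Mult semiring public using () renaming (_×_ to _⊗×_)

  1⊗^n≡1 : ∀ n → (1 , 0) ⊗^ n ≡ (1 , 0)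
  1⊗^n≡1 zero    = ≡.refl
  1⊗^n≡1 (suc n) = ≡.trans (*-identityˡ _) (1⊗^n≡1 n)

  √d⊗^[1+2h]≡d^h√d : ∀ h → (0 , 1) ⊗^ suc (2 * h) ≡ (0 , d ^ h)
  √d⊗^[1+2h]≡d^h√d zero    = cong (_, 1) (ℕ.*-zeroʳ d)
  √d⊗^[1+2h]≡d^h√d (suc h) = begin
    (0 , 1) ⊗^ suc (2 * suc h)
      ≡⟨ cong (λ k → (0 , 1) ⊗^ suc k) (2[1+h] h) ⟩
    (0 , 1) ⊗ ((0 , 1) ⊗ ((0 , 1) ⊗^ suc (2 * h)))
      ≡⟨ cong (λ u → (0 , 1) ⊗ ((0 , 1) ⊗ u)) (√d⊗^[1+2h]≡d^h√d h) ⟩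
    (0 , 1) ⊗ ((0 , 1) ⊗ (0 , d ^ h))
      ≡⟨ cong₂ _,_ (√d²₁ d (d ^ h)) (√d²₂ d (d ^ h)) ⟩
    (0 , d ^ suc h)
      ∎
    where
    open ≡.≡-Reasoning
    2[1+h] : ∀ h → 2 * suc h ≡ suc (suc (2 * h))
    2[1+h] = solve-∀
    √d²₁ : ∀ d c → 0 * (0 * 0 + d * (1 * c)) + d * (1 * (0 * c + 1 * 0)) ≡ 0
    √d²₁ = solve-∀
    √d²₂ : ∀ d c → 0 * (0 * c + 1 * 0) + 1 * (0 * 0 + d * (1 * c)) ≡ d * c
    √d²₂ = solve-∀

  ⊗×-pair : ∀ m a b → m ⊗× (a , b) ≡ (m * a , m * b)
  ⊗×-pair zero    a b = ≡.refl
  ⊗×-pair (suc m) a b = cong ((a , b) ⊕_) (⊗×-pair m a b)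

-- A record rather than a definition, so that a, b and n can be inferred from the type.
infix 4 _≡_mod_
record _≡_mod_ (a b : ℤ) (n : ℕ) : Set where
  constructor ≡mod
  field ∣difference : + n ℤ∣.∣ a ℤ.- b

+[m+k*n] : ∀ m k n → + (m + k * n) ≡ + m ℤ.+ + k ℤ.* + n
+[m+k*n] m k n = ≡.trans (ℤ.pos-+ m (k * n)) (cong (λ x → + m ℤ.+ x) (ℤ.pos-* k n))

pos-^ : ∀ m k → + (m ^ k) ≡ (+ m) ℤ.^ k
pos-^ m zero    = ≡.refl
pos-^ m (suc k) = ≡.trans (ℤ.pos-* m (m ^ k)) (cong (λ x → + m ℤ.* x) (pos-^ m k))

module Mod {n : ℕ} where

  private
    by : ∀ {a b x} → x ≡ a ℤ.- b → + n ℤ∣.∣ x → a ≡ b mod n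
    by eq n∣x = ≡mod (subst (+ n ℤ∣.∣_) eq n∣x)

  reflexive : ∀ {a b} → a ≡ b → a ≡ b mod n
  reflexive {a} ≡.refl = ≡mod (ℤ∣.divides 0ℤ (ℤ.+-inverseʳ a))

  refl : ∀ {a} → a ≡ a mod n
  refl = reflexive ≡.refl

  sym : ∀ {a b} → a ≡ b mod n → b ≡ a mod n
  sym {a} {b} (≡mod n∣a-b) = by (lemma a b) (ℤ∣.∣m⇒∣-m n∣a-b)
    where
    lemma : ∀ a b → ℤ.- (a ℤ.- b) ≡ b ℤ.- a
    lemma = ℤ-Solver.solve-∀

  trans : ∀ {a b c} → a ≡ b mod n → b ≡ c mod n → a ≡ c mod n
  trans {a} {b} {c} (≡mod n∣a-b) (≡mod n∣b-c) = by (lemma a b c) (ℤ∣.∣m∣n⇒∣m+n n∣a-b n∣b-c)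
    where
    lemma : ∀ a b c → (a ℤ.- b) ℤ.+ (b ℤ.- c) ≡ a ℤ.- c
    lemma = ℤ-Solver.solve-∀

  setoid : Setoid 0ℓ 0ℓ
  setoid = record
    { _≈_ = λ a b → a ≡ b mod n
    ; isEquivalence = record { refl = refl ; sym = sym ; trans = trans } }

  +-cong : ∀ {a b c d} → a ≡ b mod n → c ≡ d mod n → a ℤ.+ c ≡ b ℤ.+ d mod n
  +-cong {a} {b} {c} {d} (≡mod n∣a-b) (≡mod n∣c-d) = by (lemma a b c d) (ℤ∣.∣m∣n⇒∣m+n n∣a-b n∣c-d)
    where
    lemma : ∀ a b c d → (a ℤ.- b) ℤ.+ (c ℤ.- d) ≡ (a ℤ.+ c) ℤ.- (b ℤ.+ d)
    lemma = ℤ-Solver.solve-∀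

  +-cancelʳ : ∀ {a b c} → a ℤ.+ c ≡ b ℤ.+ c mod n → a ≡ b mod n
  +-cancelʳ {a} {b} {c} (≡mod n∣a+c-[b+c]) = by (lemma a b c) n∣a+c-[b+c]
    where
    lemma : ∀ a b c → (a ℤ.+ c) ℤ.- (b ℤ.+ c) ≡ a ℤ.- b
    lemma = ℤ-Solver.solve-∀

  *-cong : ∀ {a b c d} → a ≡ b mod n → c ≡ d mod n → a ℤ.* c ≡ b ℤ.* d mod n
  *-cong {a} {b} {c} {d} (≡mod n∣a-b) (≡mod n∣c-d) =
    by (lemma a b c d) (ℤ∣.∣m∣n⇒∣m+n (ℤ∣.∣n⇒∣m*n c n∣a-b) (ℤ∣.∣n⇒∣m*n b n∣c-d))
    where
    lemma : ∀ a b c d → c ℤ.* (a ℤ.- b) ℤ.+ b ℤ.* (c ℤ.- d) ≡ a ℤ.* c ℤ.- b ℤ.* d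
    lemma = ℤ-Solver.solve-∀

  ^-cong : ∀ {a b} → a ≡ b mod n → ∀ k → a ℤ.^ k ≡ b ℤ.^ k mod n
  ^-cong a≡b zero    = refl
  ^-cong a≡b (suc k) = *-cong a≡b (^-cong a≡b k)

  ≡0⇒∣ : ∀ {x} → x ≡ 0ℤ mod n → + n ℤ∣.∣ x
  ≡0⇒∣ {x} (≡mod n∣x-0) = subst (+ n ℤ∣.∣_) (ℤ.+-identityʳ x) n∣x-0

  ∣⇒≡0 : ∀ {x} → + n ℤ∣.∣ x → x ≡ 0ℤ mod n
  ∣⇒≡0 {x} n∣x = ≡mod (subst (+ n ℤ∣.∣_) (≡.sym (ℤ.+-identityʳ x)) n∣x)

  ∣⇒+≡0 : ∀ {a} → n ∣ a → + a ≡ 0ℤ mod n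
  ∣⇒+≡0 = ∣⇒≡0 ∘ ℤ∣.∣ᵤ⇒∣

  +≡0⇒∣ : ∀ {a} → + a ≡ 0ℤ mod n → n ∣ a
  +≡0⇒∣ = ℤ∣.∣⇒∣ᵤ ∘ ≡0⇒∣

  -≡0⇒≡ : ∀ {a b} → a ℤ.- b ≡ 0ℤ mod n → a ≡ b mod n
  -≡0⇒≡ a-b≡0 = ≡mod (≡0⇒∣ a-b≡0)

  +-multiple : ∀ a k → + (a + k * n) ≡ + a mod n
  +-multiple a k =
    ≡mod (ℤ∣.divides (+ k) (≡.trans (cong (ℤ._- + a) (+[m+k*n] a k n)) (lemma (+ a) (+ k) (+ n))))
    where
    lemma : ∀ a k n → a ℤ.+ k ℤ.* n ℤ.- a ≡ k ℤ.* n
    lemma = ℤ-Solver.solve-∀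

  module _ .{{_ : NonZero n}} where

    %≡%⇒≡ : ∀ {a b} → a % n ≡ b % n → + a ≡ + b mod n
    %≡%⇒≡ {a} {b} a%n≡b%n = trans (≡% a) (trans (reflexive (cong +_ a%n≡b%n)) (sym (≡% b)))
      where
      ≡% : ∀ a → + a ≡ + (a % n) mod n
      ≡% a = subst (λ x → + x ≡ + (a % n) mod n) (≡.sym (m≡m%n+[m/n]*n a n))
                   (+-multiple (a % n) (a / n))

    private
      quotient⇒%≡% : ∀ a b k → + a ℤ.- + b ≡ + k ℤ.* + n → a % n ≡ b % n
      quotient⇒%≡% a b k a-b≡kn = ≡.trans (cong (_% n) (ℤ.+-injective a≡b+kn)) ([m+kn]%n≡m%n b k n)
        where
        open ≡.≡-Reasoning
        a≡b+[a-b] : ∀ a b → a ≡ b ℤ.+ (a ℤ.- b)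
        a≡b+[a-b] = ℤ-Solver.solve-∀
        a≡b+kn : + a ≡ + (b + k * n)
        a≡b+kn = begin
          + a                       ≡⟨ a≡b+[a-b] (+ a) (+ b) ⟩
          + b ℤ.+ (+ a ℤ.- + b)     ≡⟨ cong (λ x → + b ℤ.+ x) a-b≡kn ⟩
          + b ℤ.+ + k ℤ.* + n       ≡⟨ +[m+k*n] b k n ⟨
          + (b + k * n)             ∎

    ≡⇒%≡% : ∀ {a b} → + a ≡ + b mod n → a % n ≡ b % n
    ≡⇒%≡% {a} {b} (≡mod (ℤ∣.divides (+ k) a-b≡kn)) = quotient⇒%≡% a b k a-b≡kn
    ≡⇒%≡% {a} {b} (≡mod (ℤ∣.divides -[1+ k ] a-b≡-kn)) = ≡.sym (quotient⇒%≡% b a (suc k) (begin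
      + b ℤ.- + a               ≡⟨ swap (+ a) (+ b) ⟩
      ℤ.- (+ a ℤ.- + b)         ≡⟨ cong ℤ.-_ a-b≡-kn ⟩
      ℤ.- (-[1+ k ] ℤ.* + n)    ≡⟨ ℤ.neg-distribˡ-* -[1+ k ] (+ n) ⟩
      + suc k ℤ.* + n           ∎))
      where
      open ≡.≡-Reasoning
      swap : ∀ a b → b ℤ.- a ≡ ℤ.- (a ℤ.- b)
      swap = ℤ-Solver.solve-∀

module ≡-mod-Reasoning (n : ℕ) = SetoidReasoning (Mod.setoid {n})

prime∤1 : ∀ {p} → Prime p → ¬ p ∣ 1
prime∤1 p-prime p∣1 = ¬prime[1] (subst Prime (ℕ∣.∣1⇒≡1 p∣1) p-prime)

fermat-ℕ : ∀ {p} → Prime p → ∀ a → ∃[ t ] a ^ p ≡ a + t * p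
fermat-ℕ {zero} ()
fermat-ℕ {p@(suc _)} p-prime zero    = 0 , ≡.refl
fermat-ℕ {p@(suc _)} p-prime (suc a) = t + w , (begin
  suc a ^ p                    ≡⟨ ^′≡^ (suc a) p ⟨
  suc a ^′ p                   ≡⟨ proj₂ frobenius-1+a ⟩
  1 ^′ p + a ^′ p + p ×′ w     ≡⟨ cong₂ (λ x y → x + y + p ×′ w) 1^′p≡1 (^′≡^ a p) ⟩
  1 + a ^ p + p ×′ w           ≡⟨ cong₂ (λ x y → 1 + x + y) (proj₂ fermat-a) (×′≡* p w) ⟩
  1 + (a + t * p) + p * w      ≡⟨ lemma a t w p ⟩
  suc a + (t + w) * p          ∎)
  where
  open ≡.≡-Reasoning
  open import Algebra.Properties.Semiring.Exp ℕ.+-*-semiring using () renaming (_^_ to _^′_)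
  open import Algebra.Properties.Semiring.Mult ℕ.+-*-semiring using () renaming (_×_ to _×′_)
  fermat-a : ∃[ t ] a ^ p ≡ a + t * p
  fermat-a = fermat-ℕ p-prime a
  frobenius-1+a : ∃[ w ] suc a ^′ p ≡ 1 ^′ p + a ^′ p + p ×′ w
  frobenius-1+a = frobenius ℕ.+-*-commutativeSemiring p-prime 1 a
  t w : ℕ
  t = proj₁ fermat-a
  w = proj₁ frobenius-1+a
  ^′≡^ : ∀ a n → a ^′ n ≡ a ^ n
  ^′≡^ a zero    = ≡.refl
  ^′≡^ a (suc n) = cong (a *_) (^′≡^ a n)
  ×′≡* : ∀ m a → m ×′ a ≡ m * a
  ×′≡* zero    a = ≡.refl
  ×′≡* (suc m) a = cong (_+_ a) (×′≡* m a)
  1^′p≡1 : 1 ^′ p ≡ 1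
  1^′p≡1 = ≡.trans (^′≡^ 1 p) (ℕ.^-zeroˡ p)
  lemma : ∀ a t w p → 1 + (a + t * p) + p * w ≡ suc a + (t + w) * p
  lemma = solve-∀

module _ {p : ℕ} (p-prime : Prime p) where

  fermat : ∀ a → (+ a) ℤ.^ p ≡ + a mod p
  fermat a = begin
    (+ a) ℤ.^ p        ≡⟨ pos-^ a p ⟨
    + (a ^ p)          ≡⟨ cong +_ (proj₂ (fermat-ℕ p-prime a)) ⟩
    + (a + t * p)      ≈⟨ Mod.+-multiple a t ⟩
    + a                ∎
    where
    open ≡-mod-Reasoning p
    t : ℕ
    t = proj₁ (fermat-ℕ p-prime a)

  *≡0⇒≡0⊎≡0 : ∀ a b → a ℤ.* b ≡ 0ℤ mod p → a ≡ 0ℤ mod p ⊎ b ≡ 0ℤ mod p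
  *≡0⇒≡0⊎≡0 a b ab≡0 = Sum.map (Mod.∣⇒≡0 ∘ ℤ∣.∣ᵤ⇒∣) (Mod.∣⇒≡0 ∘ ℤ∣.∣ᵤ⇒∣)
    (euclidsLemma ℤ.∣ a ∣ ℤ.∣ b ∣ p-prime (subst (p ∣_) (ℤ.abs-* a b) (ℤ∣.∣⇒∣ᵤ (Mod.≡0⇒∣ ab≡0))))

  *-cancelˡ-mod : ∀ {c a b} → ¬ p ∣ c → + c ℤ.* a ≡ + c ℤ.* b mod p → a ≡ b mod p
  *-cancelˡ-mod {c} {a} {b} p∤c (≡mod p∣ca-cb) =
    Sum.[ (λ c≡0 → contradiction (Mod.+≡0⇒∣ c≡0) p∤c) , Mod.-≡0⇒≡ ]′
      (*≡0⇒≡0⊎≡0 (+ c) (a ℤ.- b) (Mod.∣⇒≡0 (subst (+ p ℤ∣.∣_) (factor (+ c) a b) p∣ca-cb)))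
    where
    factor : ∀ c a b → c ℤ.* a ℤ.- c ℤ.* b ≡ c ℤ.* (a ℤ.- b)
    factor = ℤ-Solver.solve-∀

  square≡1⇒≡±1 : ∀ {a} → a ℤ.* a ≡ 1ℤ mod p → a ≡ 1ℤ mod p ⊎ a ≡ -1ℤ mod p
  square≡1⇒≡±1 {a} (≡mod p∣a²-1) = Sum.map Mod.-≡0⇒≡ Mod.-≡0⇒≡
    (*≡0⇒≡0⊎≡0 (a ℤ.- 1ℤ) (a ℤ.- -1ℤ) (Mod.∣⇒≡0 (subst (+ p ℤ∣.∣_) (factor a) p∣a²-1)))
    where
    factor : ∀ a → a ℤ.* a ℤ.- 1ℤ ≡ (a ℤ.- 1ℤ) ℤ.* (a ℤ.- -1ℤ)
    factor = ℤ-Solver.solve-∀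

odd-prime∤2 : ∀ h → Prime (suc (2 * h)) → ¬ suc (2 * h) ∣ 2
odd-prime∤2 zero    ()
odd-prime∤2 (suc h) _ = ℕ∣.>⇒∤ (s≤s (s≤s (ℕ.≤-trans (s≤s z≤n) (ℕ.m≤n+m _ h))))

module _ (h : ℕ) (p-prime : Prime (suc (2 * h))) where
  private
    p = suc (2 * h)

  ∤⇒^[p-1]≡1 : ∀ {a} → ¬ p ∣ a → (+ a) ℤ.^ (2 * h) ≡ 1ℤ mod p
  ∤⇒^[p-1]≡1 {a} p∤a = *-cancelˡ-mod p-prime p∤a
    (Mod.trans (fermat p-prime a) (Mod.reflexive (≡.sym (ℤ.*-identityʳ (+ a)))))

  euler-±1 : ∀ {a} → ¬ p ∣ a → (+ a) ℤ.^ h ≡ 1ℤ mod p ⊎ (+ a) ℤ.^ h ≡ -1ℤ mod p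
  euler-±1 {a} p∤a = square≡1⇒≡±1 p-prime (begin
    (+ a) ℤ.^ h ℤ.* (+ a) ℤ.^ h     ≡⟨ ℤ.^-distribˡ-+-* (+ a) h h ⟨
    (+ a) ℤ.^ (h + h)               ≡⟨ cong (λ k → (+ a) ℤ.^ (h + k)) (ℕ.+-identityʳ h) ⟨
    (+ a) ℤ.^ (2 * h)               ≈⟨ ∤⇒^[p-1]≡1 p∤a ⟩
    1ℤ                              ∎)
    where open ≡-mod-Reasoning p

  euler-square : ∀ {a s} → ¬ p ∣ a → + a ≡ + s ℤ.* + s mod p → (+ a) ℤ.^ h ≡ 1ℤ mod p
  euler-square {a} {s} p∤a a≡s² = begin
    (+ a) ℤ.^ h              ≈⟨ Mod.^-cong a≡s² h ⟩
    (+ s ℤ.* + s) ℤ.^ h      ≡⟨ cong (λ x → (+ s ℤ.* x) ℤ.^ h) (ℤ.*-identityʳ (+ s)) ⟨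
    ((+ s) ℤ.^ 2) ℤ.^ h      ≡⟨ ℤ.^-*-assoc (+ s) 2 h ⟩
    (+ s) ℤ.^ (2 * h)        ≈⟨ ∤⇒^[p-1]≡1 p∤s ⟩
    1ℤ                       ∎
    where
    open ≡-mod-Reasoning p
    p∤s : ¬ p ∣ s
    p∤s p∣s = p∤a (Mod.+≡0⇒∣ (Mod.trans a≡s² (Mod.*-cong (Mod.∣⇒+≡0 p∣s) (Mod.∣⇒+≡0 p∣s))))

fib-shift : ∀ {n k c} → + F k ≡ 0ℤ mod n → + F (suc k) ≡ c mod n →
            ∀ m → + F (m + k) ≡ c ℤ.* + F m mod n
fib-shift {n} {k} {c} F[k]≡0 F[1+k]≡c = shift
  where
  open ≡-mod-Reasoning n
  shift : ∀ m → + F (m + k) ≡ c ℤ.* + F m mod n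
  shift zero          = Mod.trans F[k]≡0 (Mod.reflexive (≡.sym (ℤ.*-zeroʳ c)))
  shift (suc zero)    = Mod.trans F[1+k]≡c (Mod.reflexive (≡.sym (ℤ.*-identityʳ c)))
  shift (suc (suc m)) = begin
    + (F (suc m + k) + F (m + k))          ≡⟨ ℤ.pos-+ (F (suc m + k)) (F (m + k)) ⟩
    + F (suc m + k) ℤ.+ + F (m + k)        ≈⟨ Mod.+-cong (shift (suc m)) (shift m) ⟩
    c ℤ.* + F (suc m) ℤ.+ c ℤ.* + F m      ≡⟨ ℤ.*-distribˡ-+ c (+ F (suc m)) (+ F m) ⟨
    c ℤ.* (+ F (suc m) ℤ.+ + F m)          ≡⟨ cong (c ℤ.*_) (ℤ.pos-+ (F (suc m)) (F m)) ⟨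
    c ℤ.* + (F (suc m) + F m)              ∎

∣F∧∣F[1+]⇒∣1 : ∀ {n} m → n ∣ F m → n ∣ F (suc m) → n ∣ 1
∣F∧∣F[1+]⇒∣1 zero    _         n∣F₁     = n∣F₁
∣F∧∣F[1+]⇒∣1 (suc m) n∣F[1+m] n∣F[2+m] = ∣F∧∣F[1+]⇒∣1 m (ℕ∣.∣m+n∣m⇒∣n n∣F[2+m] n∣F[1+m]) n∣F[1+m]

module _ {p : ℕ} (p-prime : Prime p) where

  ∣F-∸ : ∀ {a b} → p ∣ F a → p ∣ F (a + b) → p ∣ F b
  ∣F-∸ {a} {b} p∣F[a] p∣F[a+b] =
    Sum.[ F[1+a]≢0 , Mod.+≡0⇒∣ ]′ (*≡0⇒≡0⊎≡0 p-prime (+ F (suc a)) (+ F b) F[1+a]F[b]≡0)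
    where
    open ≡-mod-Reasoning p
    F[1+a]F[b]≡0 : + F (suc a) ℤ.* + F b ≡ 0ℤ mod p
    F[1+a]F[b]≡0 = begin
      + F (suc a) ℤ.* + F b    ≈⟨ fib-shift (Mod.∣⇒+≡0 p∣F[a]) Mod.refl b ⟨
      + F (b + a)              ≡⟨ cong (λ k → + F k) (ℕ.+-comm b a) ⟩
      + F (a + b)              ≈⟨ Mod.∣⇒+≡0 p∣F[a+b] ⟩
      0ℤ                       ∎
    F[1+a]≢0 : + F (suc a) ≡ 0ℤ mod p → p ∣ F b
    F[1+a]≢0 F[1+a]≡0 = contradiction (∣F∧∣F[1+]⇒∣1 a p∣F[a] (Mod.+≡0⇒∣ F[1+a]≡0)) (prime∤1 p-prime)

module _ where
  open ℕ[√d] 5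

  [1+√5]^[1+n] : ∀ n → (1 , 1) ⊗^ suc n ≡ (2 ^ n * (2 * F n + F (suc n)) , 2 ^ n * F (suc n))
  [1+√5]^[1+n] zero    = ≡.refl
  [1+√5]^[1+n] (suc n) = ≡.trans (cong ((1 , 1) ⊗_) ([1+√5]^[1+n] n))
    (cong₂ _,_ (lemma₁ (2 ^ n) (F n) (F (suc n))) (lemma₂ (2 ^ n) (F n) (F (suc n))))
    where
    lemma₁ : ∀ t a b → 1 * (t * (2 * a + b)) + 5 * (1 * (t * b)) ≡ (2 * t) * (2 * b + (b + a))
    lemma₁ = solve-∀
    lemma₂ : ∀ t a b → 1 * (t * b) + 1 * (t * (2 * a + b)) ≡ (2 * t) * (b + a)
    lemma₂ = solve-∀

  module _ (h : ℕ) (p-prime : Prime (suc (2 * h))) where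
    private
      p = suc (2 * h)

    fibonacci-frobenius : + (2 ^ (2 * h) * (2 * F (2 * h) + F p)) ≡ 1ℤ mod p
                        × + (2 ^ (2 * h) * F p) ≡ + (5 ^ h) mod p
    fibonacci-frobenius = multiple (cong proj₁ components) , multiple (cong proj₂ components)
      where
      open ≡.≡-Reasoning
      expansion : ∃[ w ] (1 , 1) ⊗^ p ≡ (1 , 0) ⊗^ p ⊕ (0 , 1) ⊗^ p ⊕ p ⊗× w
      expansion = frobenius +-*-commutativeSemiring p-prime (1 , 0) (0 , 1)
      w : ℕ × ℕ
      w = proj₁ expansion
      components : (2 ^ (2 * h) * (2 * F (2 * h) + F p) , 2 ^ (2 * h) * F p)
                 ≡ (1 + p * proj₁ w , 5 ^ h + p * proj₂ w)
      components = begin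
        (2 ^ (2 * h) * (2 * F (2 * h) + F p) , 2 ^ (2 * h) * F p)
          ≡⟨ [1+√5]^[1+n] (2 * h) ⟨
        (1 , 1) ⊗^ p
          ≡⟨ proj₂ expansion ⟩
        (1 , 0) ⊗^ p ⊕ (0 , 1) ⊗^ p ⊕ p ⊗× w
          ≡⟨ cong₂ (λ u v → u ⊕ v ⊕ p ⊗× w) (1⊗^n≡1 p) (√d⊗^[1+2h]≡d^h√d h) ⟩
        (1 , 0) ⊕ (0 , 5 ^ h) ⊕ p ⊗× w
          ≡⟨ cong ((1 , 5 ^ h) ⊕_) (⊗×-pair p (proj₁ w) (proj₂ w)) ⟩
        (1 + p * proj₁ w , 5 ^ h + p * proj₂ w)
          ∎
      multiple : ∀ {a b k} → a ≡ b + p * k → + a ≡ + b mod p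
      multiple {b = b} {k} ≡.refl =
        subst (λ x → + (b + x) ≡ + b mod p) (ℕ.*-comm k p) (Mod.+-multiple b k)

module _ (h : ℕ) (p-prime : Prime (suc (2 * h))) where
  private
    p = suc (2 * h)

    cancel-2^[p-1] : ∀ {x y} → + (2 ^ (2 * h) * x) ≡ y mod p → + x ≡ y mod p
    cancel-2^[p-1] {x} {y} 2^[p-1]x≡y = begin
      + x                           ≡⟨ ℤ.*-identityˡ (+ x) ⟨
      1ℤ ℤ.* + x                    ≈⟨ Mod.*-cong (Mod.sym 2^[p-1]≡1) Mod.refl ⟩
      (+ 2) ℤ.^ (2 * h) ℤ.* + x     ≡⟨ cong (ℤ._* + x) (pos-^ 2 (2 * h)) ⟨
      + (2 ^ (2 * h)) ℤ.* + x       ≡⟨ ℤ.pos-* (2 ^ (2 * h)) x ⟨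
      + (2 ^ (2 * h) * x)           ≈⟨ 2^[p-1]x≡y ⟩
      y                             ∎
      where
      open ≡-mod-Reasoning p
      2^[p-1]≡1 : (+ 2) ℤ.^ (2 * h) ≡ 1ℤ mod p
      2^[p-1]≡1 = ∤⇒^[p-1]≡1 h p-prime (odd-prime∤2 h p-prime)

  -- ε is the value ±1 of 5^h, and x stands for (1 - ε) / 2.
  fibonacci-residues : ∀ {ε x} → (+ 5) ℤ.^ h ≡ ε mod p → + 2 ℤ.* x ℤ.+ ε ≡ 1ℤ mod p →
                       + F (2 * h) ≡ x mod p × + F p ≡ ε mod p
  fibonacci-residues {ε} {x} 5^h≡ε 2x+ε≡1 = F[p-1]≡x , F[p]≡ε
    where
    open ≡-mod-Reasoning p
    F[p]≡ε : + F p ≡ ε mod p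
    F[p]≡ε = begin
      + F p            ≈⟨ cancel-2^[p-1] (proj₂ (fibonacci-frobenius h p-prime)) ⟩
      + (5 ^ h)        ≡⟨ pos-^ 5 h ⟩
      (+ 5) ℤ.^ h      ≈⟨ 5^h≡ε ⟩
      ε                ∎
    F[p-1]≡x : + F (2 * h) ≡ x mod p
    F[p-1]≡x = *-cancelˡ-mod p-prime (odd-prime∤2 h p-prime) (Mod.+-cancelʳ (begin
      + 2 ℤ.* + F (2 * h) ℤ.+ ε        ≈⟨ Mod.+-cong (Mod.refl {a = + 2 ℤ.* + F (2 * h)}) (Mod.sym F[p]≡ε) ⟩
      + 2 ℤ.* + F (2 * h) ℤ.+ + F p    ≡⟨ cong (ℤ._+ + F p) (ℤ.pos-* 2 (F (2 * h))) ⟨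
      + (2 * F (2 * h)) ℤ.+ + F p      ≡⟨ ℤ.pos-+ (2 * F (2 * h)) (F p) ⟨
      + (2 * F (2 * h) + F p)          ≈⟨ cancel-2^[p-1] (proj₁ (fibonacci-frobenius h p-prime)) ⟩
      1ℤ                               ≈⟨ Mod.sym 2x+ε≡1 ⟩
      + 2 ℤ.* x ℤ.+ ε                  ∎))

square⇒∣F[p-1] : ∀ h {s} → Prime (suc (2 * h)) → ¬ suc (2 * h) ∣ 5 →
                 + 5 ≡ + s ℤ.* + s mod suc (2 * h) → suc (2 * h) ∣ F (2 * h)
square⇒∣F[p-1] h {s} p-prime p∤5 5≡s² = Mod.+≡0⇒∣ (proj₁ (fibonacci-residues h p-prime 5^h≡1 Mod.refl))
  where
  5^h≡1 : (+ 5) ℤ.^ h ≡ 1ℤ mod suc (2 * h)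
  5^h≡1 = euler-square h p-prime {s = s} p∤5 5≡s²

-- IsRankOfApparition p and IsPisanoPeriod n are LeastPositive (λ j → p ∣ F j) and
-- LeastPositive FibonacciPeriod.
LeastPositive : (ℕ → Set) → ℕ → Set
LeastPositive P z = 0 < z × P z × (∀ j → 0 < j → P j → z ≤ j)

least-positive-∣ : ∀ (P : ℕ → Set) {z n} → (∀ {a b} → P a → P (a + b) → P b) →
                   LeastPositive P z → P n → z ∣ n
least-positive-∣ P {z} {n} P-∸ (0<z , P[z] , least) P[n] = ℕ∣.m%n≡0⇒n∣m n z n%z≡0
  where
  instance
    z≢0 : NonZero z
    z≢0 = ℕ.>-nonZero 0<z

  P-remainder : ∀ r k → P (r + k * z) → P r
  P-remainder r zero    P[r+0]     = subst P (ℕ.+-identityʳ r) P[r+0]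
  P-remainder r (suc k) P[r+z+kz] = P-remainder r k (P-∸ P[z] (subst P (swap r z (k * z)) P[r+z+kz]))
    where
    swap : ∀ r z x → r + (z + x) ≡ z + (r + x)
    swap = solve-∀

  P[n%z] : P (n % z)
  P[n%z] = P-remainder (n % z) (n / z) (subst P (m≡m%n+[m/n]*n n z) P[n])

  n%z≡0 : n % z ≡ 0
  n%z≡0 with n % z | P[n%z] | m%n<n n z
  ... | zero  | _      | _     = ≡.refl
  ... | suc r | P[1+r] | 1+r<z = contradiction (least (suc r) (s≤s z≤n) P[1+r]) (ℕ.<⇒≱ 1+r<z)

rank∣ : ∀ {p z n} → Prime p → IsRankOfApparition p z → p ∣ F n → z ∣ n
rank∣ {p} p-prime = least-positive-∣ (λ j → p ∣ F j) (λ {a} {b} → ∣F-∸ p-prime {a} {b})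

module _ {n : ℕ} .{{_ : NonZero n}} where

  FibonacciPeriod : ℕ → Set
  FibonacciPeriod j = ∀ m → F (m + j) % n ≡ F m % n

  period-∸ : ∀ {a b} → FibonacciPeriod a → FibonacciPeriod (a + b) → FibonacciPeriod b
  period-∸ {a} {b} period-a period-a+b m = begin
    F (m + b) % n            ≡⟨ period-a (m + b) ⟨
    F (m + b + a) % n        ≡⟨ cong (λ k → F k % n) (swap m b a) ⟩
    F (m + (a + b)) % n      ≡⟨ period-a+b m ⟩
    F m % n                  ∎
    where
    open ≡.≡-Reasoning
    swap : ∀ m b a → m + b + a ≡ m + (a + b)
    swap = solve-∀

  pisano∣ : ∀ {π j} → IsPisanoPeriod n π → FibonacciPeriod j → π ∣ j
  pisano∣ = least-positive-∣ FibonacciPeriod period-∸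

module _ (h : ℕ) (r-prime : Prime (suc (2 * h))) where
  private
    r = suc (2 * h)

  r-1-period : (+ 5) ℤ.^ h ≡ 1ℤ mod r → FibonacciPeriod (2 * h)
  r-1-period 5^h≡1 m = Mod.≡⇒%≡% (begin
    + F (m + 2 * h)        ≈⟨ fib-shift (proj₁ residues) (proj₂ residues) m ⟩
    1ℤ ℤ.* + F m           ≡⟨ ℤ.*-identityˡ (+ F m) ⟩
    + F m                  ∎)
    where
    open ≡-mod-Reasoning r
    residues : + F (2 * h) ≡ 0ℤ mod r × + F r ≡ 1ℤ mod r
    residues = fibonacci-residues h r-prime 5^h≡1 Mod.refl

  2[r+1]-period : (+ 5) ℤ.^ h ≡ -1ℤ mod r → FibonacciPeriod (suc r + suc r)
  2[r+1]-period 5^h≡-1 m = Mod.≡⇒%≡% (begin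
    + F (m + (suc r + suc r))       ≡⟨ cong (λ k → + F k) (ℕ.+-assoc m (suc r) (suc r)) ⟨
    + F (m + suc r + suc r)         ≈⟨ antiperiod (m + suc r) ⟩
    -1ℤ ℤ.* + F (m + suc r)         ≈⟨ Mod.*-cong (Mod.refl {a = -1ℤ}) (antiperiod m) ⟩
    -1ℤ ℤ.* (-1ℤ ℤ.* + F m)         ≡⟨ neg-involutive (+ F m) ⟩
    + F m                           ∎)
    where
    open ≡-mod-Reasoning r
    residues : + F (2 * h) ≡ 1ℤ mod r × + F r ≡ -1ℤ mod r
    residues = fibonacci-residues h r-prime 5^h≡-1 Mod.refl
    F[1+r]≡0 : + F (suc r) ≡ 0ℤ mod r
    F[1+r]≡0 = begin
      + (F r + F (2 * h))          ≡⟨ ℤ.pos-+ (F r) (F (2 * h)) ⟩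
      + F r ℤ.+ + F (2 * h)        ≈⟨ Mod.+-cong (proj₂ residues) (proj₁ residues) ⟩
      0ℤ                           ∎
    F[2+r]≡-1 : + F (suc (suc r)) ≡ -1ℤ mod r
    F[2+r]≡-1 = begin
      + (F (suc r) + F r)          ≡⟨ ℤ.pos-+ (F (suc r)) (F r) ⟩
      + F (suc r) ℤ.+ + F r        ≈⟨ Mod.+-cong F[1+r]≡0 (proj₂ residues) ⟩
      -1ℤ                          ∎
    antiperiod : ∀ m → + F (m + suc r) ≡ -1ℤ ℤ.* + F m mod r
    antiperiod = fib-shift F[1+r]≡0 F[2+r]≡-1
    neg-involutive : ∀ x → -1ℤ ℤ.* (-1ℤ ℤ.* x) ≡ x
    neg-involutive = ℤ-Solver.solve-∀

  odd-prime∤pisano : ∀ {π} → ¬ r ∣ 5 → IsPisanoPeriod r π → ¬ r ∣ π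
  odd-prime∤pisano r∤5 pisano r∣π = Sum.[ r∤2h ∘ ∣period , r∤2[r+1] ∘ ∣period ]′
    (Sum.map r-1-period 2[r+1]-period (euler-±1 h r-prime r∤5))
    where
    ∣period : ∀ {j} → FibonacciPeriod j → r ∣ j
    ∣period period = ℕ∣.∣-trans r∣π (pisano∣ pisano period)
    r∤2h : ¬ r ∣ 2 * h
    r∤2h r∣2h = prime∤1 r-prime (ℕ∣.∣m+n∣m⇒∣n (subst (r ∣_) (ℕ.+-comm 1 (2 * h)) ℕ∣.∣-refl) r∣2h)
    r∤2[r+1] : ¬ r ∣ suc r + suc r
    r∤2[r+1] r∣2r+2 = odd-prime∤2 h r-prime
      (ℕ∣.∣m+n∣m⇒∣n (ℕ∣.∣m+n∣m⇒∣n (subst (r ∣_) (2[1+r]≡r+[r+2] r) r∣2r+2) ℕ∣.∣-refl) ℕ∣.∣-refl)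
      where
      2[1+r]≡r+[r+2] : ∀ r → suc r + suc r ≡ r + (r + 2)
      2[1+r]≡r+[r+2] = solve-∀

odd-prime : ∀ {p} → Prime p → 2 < p → ∃[ h ] p ≡ suc (2 * h)
odd-prime {p} p-prime 2<p with p % 2 | m≡m%n+[m/n]*n p 2 | m%n<n p 2
... | zero        | p≡[p/2]*2   | _ = Sum.[ (λ ()) , (λ 2≡p → contradiction 2≡p (ℕ.<⇒≢ 2<p)) ]′
                                        (prime⇒irreducible p-prime (ℕ∣.divides (p / 2) p≡[p/2]*2))
... | suc zero    | p≡1+[p/2]*2 | _ = p / 2 , ≡.trans p≡1+[p/2]*2 (cong suc (ℕ.*-comm (p / 2) 2))
... | suc (suc _) | _           | s≤s (s≤s ())

prime∤pisano : ∀ {r π} .{{_ : NonZero r}} → Prime r → 2 < r → ¬ r ∣ 5 → IsPisanoPeriod r π → ¬ r ∣ π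
prime∤pisano r-prime 2<r r∤5 with odd-prime r-prime 2<r
... | h , ≡.refl = odd-prime∤pisano h r-prime r∤5

prime∤⇒coprime : ∀ {q z} → Prime q → ¬ q ∣ z → Coprime z q
prime∤⇒coprime q-prime q∤z (d∣z , d∣q) with prime⇒irreducible q-prime d∣q
... | inj₁ d≡1    = d≡1
... | inj₂ ≡.refl = contradiction d∣z q∤z

∣2⇒F≡1 : ∀ {z} → z ∣ 2 → F z ≡ 1
∣2⇒F≡1 {0}                 0∣2 = contradiction (ℕ∣.0∣⇒≡0 0∣2) λ ()
∣2⇒F≡1 {1}                 _   = ≡.refl
∣2⇒F≡1 {2}                 _   = ≡.refl
∣2⇒F≡1 {suc (suc (suc _))} z∣2 = contradiction (ℕ∣.∣⇒≤ z∣2) λ { (s≤s (s≤s ())) }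

∣2q⇒q∣⊎F≡1 : ∀ {q z} → Prime q → z ∣ 2 * q → q ∣ z ⊎ F z ≡ 1
∣2q⇒q∣⊎F≡1 {q} {z} q-prime z∣2q with q ℕ∣.∣? z
... | yes q∣z = inj₁ q∣z
... | no  q∤z = inj₂ (∣2⇒F≡1 (coprime-divisor (prime∤⇒coprime q-prime q∤z) z∣q*2))
  where
  z∣q*2 : z ∣ q * 2
  z∣q*2 = subst (z ∣_) (ℕ.*-comm 2 q) z∣2q

q∣rank : ∀ {q z} → Prime q → Prime (suc (2 * q)) → IsRankOfApparition (suc (2 * q)) z →
         suc (2 * q) ∣ F (2 * q) → q ∣ z
q∣rank {q} q-prime p-prime rank p∣F[2q] with ∣2q⇒q∣⊎F≡1 q-prime (rank∣ p-prime rank p∣F[2q])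
... | inj₁ q∣z    = q∣z
... | inj₂ F[z]≡1 = contradiction (subst (suc (2 * q) ∣_) F[z]≡1 (proj₁ (proj₂ rank))) (prime∤1 p-prime)

legendre≡-1 : ∀ {a p} .{{_ : NonZero p}} → ¬ p ∣ a → (∀ s → ¬ (s * s) % p ≡ a % p) →
              legendre a p ≡ -[1+ 0 ]
legendre≡-1 {a} {p} p∤a non-residue with p ℕ∣.∣? a
... | yes p∣a = contradiction p∣a p∤a
... | no _ with any? (λ (x : Fin p) → (toℕ x * toℕ x) % p ℕ.≟ a % p)
...   | yes (x , x²≡a) = contradiction x²≡a (non-residue (toℕ x))
...   | no _           = ≡.refl

theorem6p1 : (q : ℕ) → .{{_ : NonZero q}} → SophieGermain q → 5 < q →
    (z π : ℕ) → IsRankOfApparition (suc (2 * q)) z → IsPisanoPeriod q π →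
    z ∣ π → legendre 5 (suc (2 * q)) ≡ -[1+ 0 ]
theorem6p1 q (q-prime , p-prime) 5<q z π rank pisano z∣π = legendre≡-1 p∤5 λ s s²≡5 →
  prime∤pisano q-prime 2<q (ℕ∣.>⇒∤ 5<q) pisano
    (ℕ∣.∣-trans (q∣rank q-prime p-prime rank (p∣F[2q] s s²≡5)) z∣π)
  where
  p = suc (2 * q)
  2<q : 2 < q
  2<q = ℕ.<-trans (s≤s (s≤s (s≤s z≤n))) 5<q
  p∤5 : ¬ p ∣ 5
  p∤5 = ℕ∣.>⇒∤ (ℕ.<-trans 5<q (s≤s (ℕ.m≤n*m q 2)))
  p∣F[2q] : ∀ s → (s * s) % p ≡ 5 % p → p ∣ F (2 * q)
  p∣F[2q] s s²≡5 = square⇒∣F[p-1] q {s} p-prime p∤5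
    (Mod.trans (Mod.sym (Mod.%≡%⇒≡ s²≡5)) (Mod.reflexive (ℤ.pos-* s s)))
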